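{- For any $\varepsilon>0$, there exists a strictly $(1+\varepsilon)$-competitive deterministic online algorithm with advice for multi-coloring bipartite graphs with advice complexity $O(\log\log \mathrm{Opt})$.
   Context: Online multi-coloring: the graph is known in advance; requests arrive one at a time, each naming a node $v$, and must immediately and irrevocably receive a color (positive integer) different from every color previously assigned to $v$ or any neighbor of $v$. $A(I)$ is the number of colors used by algorithm $A$ on request sequence $I$ and $\mathrm{Opt}=\mathrm{Opt}(I)$ is the minimum number of colors an offline algorithm needs on $I$. Advice model: an all-powerful oracle knowing $I$ writes an infinite binary advice tape; advice complexity is the maximum index of a bit read. Strictly $c$-competitive means $A(I)\le c\cdot\mathrm{Opt}(I)$ for all $I$.
   Formalization: The parameter ε ranges over the positive rationals. -}

module Defs where

open import Data.Nat as ℕ using (ℕ; zero; suc; _≤_; _≟_)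
open import Data.Integer using (+_)
open import Data.Rational as ℚ using (ℚ; _/_)
open import Data.Fin using (Fin)
open import Data.Bool using (Bool; true)
open import Data.List using (List; []; _∷_; _++_; map; length; upTo; deduplicate; zip)
open import Data.List.Relation.Unary.All using (All)
open import Data.Product using (_×_; _,_; Σ; proj₁; proj₂)
open import Data.Sum using (_⊎_)
open import Data.Unit using (⊤)
open import Relation.Binary.PropositionalEquality using (_≡_; _≢_)
open import Relation.Nullary using (¬_)

Adj : ℕ → Set
Adj n = Fin n → Fin n → Bool

SimpleGraph : (n : ℕ) → Adj n → Set
SimpleGraph n E = (∀ u v → E u v ≡ E v u) × (∀ v → ¬ (E v v ≡ true))

Bipartite : (n : ℕ) → Adj n → Set
Bipartite n E = Σ (Fin n → Bool) λ side → ∀ u v → E u v ≡ true → side u ≢ side v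

Compatible : {n : ℕ} → Adj n → Fin n × ℕ → Fin n × ℕ → Set
Compatible E (v , c) (u , d) = (v ≡ u ⊎ E v u ≡ true) → c ≢ d

-- validity of a chronological list of (requested node, assigned colour):
-- colours are positive integers and each differs from all earlier colours
-- at the same node or at neighbours.
ValidAcc : {n : ℕ} → Adj n → List (Fin n × ℕ) → List (Fin n × ℕ) → Set
ValidAcc E past [] = ⊤
ValidAcc E past (x ∷ xs) =
  (1 ≤ proj₂ x) × All (Compatible E x) past × ValidAcc E (x ∷ past) xs

Valid : {n : ℕ} → Adj n → List (Fin n × ℕ) → Set
Valid E = ValidAcc E []

numColors : List ℕ → ℕ
numColors cs = length (deduplicate _≟_ cs)

OfflineColoring : {n : ℕ} → Adj n → List (Fin n) → List ℕ → Set
OfflineColoring E I cs = (length cs ≡ length I) × Valid E (zip I cs)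

IsOpt : {n : ℕ} → Adj n → List (Fin n) → ℕ → Set
IsOpt E I k =
  Σ (List ℕ) (λ cs → OfflineColoring E I cs × numColors cs ≡ k)
  × (∀ cs → OfflineColoring E I cs → k ≤ numColors cs)

-- Adaptive reading of advice bits: the advice tape is read sequentially
-- (WLOG, since advice complexity is the maximum index of a bit read).
data Reader (A : Set) : Set where
  done : A → Reader A
  read : (Bool → Reader A) → Reader A

runReader : {A : Set} → Reader A → (ℕ → Bool) → ℕ → A × ℕ
runReader (done a) t p = a , p
runReader (read f) t p = runReader (f (t p)) t (suc p)

-- Deterministic online multi-colouring algorithm with advice: knows the graph
-- in advance; at each request it sees the advice bits read so far, the
-- history of (request, colour) pairs, and the current request, may read
-- further advice bits, and outputs a colour.
OnlineAlg : Set
OnlineAlg = (n : ℕ) → (E : Adj n) → (bitsRead : List Bool) →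
            (history : List (Fin n × ℕ)) → (v : Fin n) → Reader ℕ

runFrom : OnlineAlg → (n : ℕ) → Adj n → (ℕ → Bool) →
          List (Fin n) → ℕ → List (Fin n × ℕ) → List (Fin n × ℕ) × ℕ
runFrom A n E t [] pos hist = hist , pos
runFrom A n E t (v ∷ vs) pos hist =
  let r = runReader (A n E (map t (upTo pos)) hist v) t pos
  in runFrom A n E t vs (proj₂ r) (hist ++ ((v , proj₁ r) ∷ []))

run : OnlineAlg → (n : ℕ) → Adj n → (ℕ → Bool) → List (Fin n) →
      List (Fin n × ℕ) × ℕ
run A n E t I = runFrom A n E t I 0 []

-- colours produced / advice complexity (max index, 1-based, of a bit read)
output : {n : ℕ} → List (Fin n × ℕ) × ℕ → List (Fin n × ℕ)
output = proj₁

adviceUsed : {n : ℕ} → List (Fin n × ℕ) × ℕ → ℕ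
adviceUsed = proj₂

ℕtoℚ : ℕ → ℚ
ℕtoℚ k = (+ k) / 1

-- Requests to one node, or to the two ends of an edge,
-- pairwise conflict, so every colouring gives them distinct colours (the
-- clique bound).  Hence the maximum load K of I (most requests to a node or
-- an edge) satisfies K ≤ Opt.
--
-- The oracle rounds K up to M = m * 2 ^ e with m ≤ 2N, losing a
-- factor 1 + 1/N, and writes a self-delimiting codeword for M: L in unary,
-- e with L ≈ log log K binary digits, m in unary.  The algorithm reads H
-- bits at the first request and one bit at each later one until the
-- codeword is complete (a request can only read boundedly many bits);
-- meanwhile every request gets a fresh colour.  Then
-- it knows M and a bipartition (found by exhaustive search): the j-th
-- request to a node gets colour R + j on one side and R + (M + 1 - j) on the
-- other, R being the number of fresh colours.  As every node and every edge
-- carries at most M requests, this colouring is valid and uses R + M colours.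
--
-- With N = 2(q+1) for ε ≥ 1/(q+1) the theorem then combines these
-- bounds: colours ≤ R + M ≤ (1 + 2/N) K ≤ (1 + ε) Opt, advice ≤ length of
-- the codeword = O(log log K + N).
module Submission where

open import Defs
open import Data.Nat using (ℕ; zero; suc; _+_; _*_; _∸_; _^_; _≤_; _<_; _≤?_; _<?_; _⊓_; _⊔_; z≤n; s≤s; NonZero)
open import Data.Nat.Base using (⌈_/2⌉; >-nonZero⁻¹)
open import Data.Nat.Properties
open import Data.Nat.Logarithm using (⌈log₂_⌉; ⌈log₂⌉-mono-≤; ⌈log₂2^n⌉≡n)
open import Data.Nat.Logarithm.Core using (⌈log2⌉)
open import Data.Nat.Tactic.RingSolver using (solve-∀)
open import Data.Nat.Coprimality as Coprimality using (Coprime)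
open import Data.Integer as ℤ using (+[1+_]; -[1+_]; +<+)
import Data.Integer.Properties as ℤ
open import Data.Rational as ℚ using (ℚ; 0ℚ; 1ℚ; mkℚ; *<*)
import Data.Rational.Properties as ℚ
import Data.Rational.Unnormalised as ℚᵘ
import Data.Rational.Unnormalised.Properties as ℚᵘ
open import Data.Bool using (Bool; true; false)
open import Data.Bool.Properties using () renaming (_≟_ to _≟ᵇ_)
open import Data.Fin as Fin using (Fin)
open import Data.Fin.Properties using (all?) renaming (_≟_ to _≟ᶠ_)
open import Data.Fin.Subset using (Subset)
open import Data.Fin.Subset.Properties using (anySubset?)
open import Data.Vec using (lookup; tabulate)
open import Data.Vec.Properties using (lookup∘tabulate)
open import Data.Maybe using (Maybe; just; nothing)
open import Data.List using (List; []; _∷_; _++_; map; length; filter; deduplicate; zip; take; replicate; applyUpTo; upTo)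
import Data.List.Properties as List
open import Data.List.Membership.Propositional using (_∈_; _∉_)
import Data.List.Membership.Propositional.Properties as ∈
open import Data.List.Relation.Unary.Any as Any using (here; there)
open import Data.List.Relation.Unary.All as All using (All; []; _∷_)
open import Data.List.Relation.Unary.AllPairs using ([]; _∷_)
open import Data.List.Relation.Unary.Unique.Propositional using (Unique)
import Data.List.Relation.Unary.Unique.DecPropositional.Properties as Unique
open import Data.Product using (Σ; ∃; ∃₂; _×_; _,_; proj₁; proj₂)
open import Data.Sum using (_⊎_; inj₁; inj₂)
open import Data.Empty using (⊥-elim)
open import Data.Unit using (tt)
open import Relation.Nullary using (¬_; Dec; yes; no; does; ¬?)
open import Relation.Nullary.Decidable using (_⊎-dec_; _→-dec_)
open import Relation.Unary using (Pred; Decidable)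
open import Relation.Binary.Definitions using (DecidableEquality)
open import Relation.Binary.PropositionalEquality using (_≡_; _≢_; refl; sym; trans; cong; cong₂; subst; subst₂; module ≡-Reasoning)
open import Induction.WellFounded using (Acc; acc)
open import Function using (_∘_)
open import Level using (0ℓ)

unique⊆⇒length≤ : {A : Set} → DecidableEquality A → {xs ys : List A} →
                  Unique xs → (∀ {x} → x ∈ xs → x ∈ ys) → length xs ≤ length ys
unique⊆⇒length≤ _≟_ {[]} _ _ = z≤n
unique⊆⇒length≤ _≟_ {x ∷ xs} {ys} (x∉xs ∷ uniq) xs⊆ys = begin
  suc (length xs)            ≤⟨ s≤s (unique⊆⇒length≤ _≟_ uniq xs⊆others) ⟩
  suc (length (filter ≢x? ys)) ≤⟨ List.filter-notAll ≢x? ys (Any.map (λ x≡y x≢y → x≢y x≡y) (xs⊆ys (here refl))) ⟩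
  length ys                  ∎
  where
  open ≤-Reasoning
  ≢x? : Decidable (λ y → ¬ x ≡ y)
  ≢x? y = ¬? (x ≟ y)
  xs⊆others : ∀ {z} → z ∈ xs → z ∈ filter ≢x? ys
  xs⊆others z∈xs = ∈.∈-filter⁺ ≢x? (xs⊆ys (there z∈xs)) (λ x≡z → All.lookup x∉xs z∈xs x≡z)

countBy : {A : Set} {P : Pred A 0ℓ} → Decidable P → List A → ℕ
countBy P? xs = length (filter P? xs)

countBy-++ : {A : Set} {P : Pred A 0ℓ} (P? : Decidable P) (xs ys : List A) →
             countBy P? (xs ++ ys) ≡ countBy P? xs + countBy P? ys
countBy-++ P? xs ys = trans (cong length (List.filter-++ P? xs ys)) (List.length-++ (filter P? xs))

count : {n : ℕ} → Fin n → List (Fin n) → ℕ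
count v = countBy (λ w → w ≟ᶠ v)

count-here : {n : ℕ} (v : Fin n) (xs : List (Fin n)) → count v (v ∷ xs) ≡ suc (count v xs)
count-here v xs with v ≟ᶠ v
... | yes _ = refl
... | no v≢v = ⊥-elim (v≢v refl)

count-++ˡ : {n : ℕ} (v : Fin n) (xs ys : List (Fin n)) → count v xs ≤ count v (xs ++ ys)
count-++ˡ v xs ys = subst (count v xs ≤_) (sym (countBy-++ (λ w → w ≟ᶠ v) xs ys)) (m≤m+n _ _)

count-<-occurrence : {n : ℕ} (v : Fin n) (xs ys : List (Fin n)) → count v xs < count v (xs ++ v ∷ ys)
count-<-occurrence v xs ys = begin-strict
  count v xs                        <⟨ n<1+n _ ⟩
  suc (count v xs)                  ≤⟨ m≤m+n _ (count v ys) ⟩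
  suc (count v xs) + count v ys     ≡⟨ sym (+-suc (count v xs) (count v ys)) ⟩
  count v xs + suc (count v ys)     ≡⟨ cong (count v xs +_) (sym (count-here v ys)) ⟩
  count v xs + count v (v ∷ ys)     ≡⟨ sym (countBy-++ (λ w → w ≟ᶠ v) xs (v ∷ ys)) ⟩
  count v (xs ++ v ∷ ys)            ∎
  where open ≤-Reasoning

Conflict : {n : ℕ} → Adj n → Fin n → Fin n → Set
Conflict E a b = a ≡ b ⊎ E a b ≡ true

conflict? : {n : ℕ} (E : Adj n) → ∀ a b → Dec (Conflict E a b)
conflict? E a b = (a ≟ᶠ b) ⊎-dec (E a b ≟ᵇ true)

conflict-sym : {n : ℕ} {E : Adj n} → (∀ u v → E u v ≡ E v u) → ∀ {a b} → Conflict E a b → Conflict E b a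
conflict-sym symmetric (inj₁ a≡b) = inj₁ (sym a≡b)
conflict-sym symmetric {a} {b} (inj₂ ab) = inj₂ (trans (symmetric b a) ab)

map-proj₁-zip : {A B : Set} (xs : List A) (ys : List B) → length ys ≡ length xs → map proj₁ (zip xs ys) ≡ xs
map-proj₁-zip [] [] _ = refl
map-proj₁-zip (x ∷ xs) (y ∷ ys) eq = cong (x ∷_) (map-proj₁-zip xs ys (suc-injective eq))

map-proj₂-zip : {A B : Set} (xs : List A) (ys : List B) → length ys ≡ length xs → map proj₂ (zip xs ys) ≡ ys
map-proj₂-zip [] [] _ = refl
map-proj₂-zip (x ∷ xs) (y ∷ ys) eq = cong (y ∷_) (map-proj₂-zip xs ys (suc-injective eq))

countBy-map : {A B : Set} {P : Pred B 0ℓ} (P? : Decidable P) (f : A → B) (xs : List A) →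
              length (filter (P? ∘ f) xs) ≡ countBy P? (map f xs)
countBy-map P? f [] = refl
countBy-map P? f (x ∷ xs) with does (P? (f x))
... | true = cong suc (countBy-map P? f xs)
... | false = countBy-map P? f xs

-- Clique bound: requests to a set S of pairwise conflicting nodes receive
-- pairwise distinct colours in every valid colouring, so any offline
-- colouring uses at least as many colours as there are requests to S.
module CliqueBound {n : ℕ} (E : Adj n) {S : Pred (Fin n) 0ℓ} (S? : Decidable S)
                   (clique : ∀ a b → S a → S b → Conflict E a b) where

  coloursAtS : List (Fin n × ℕ) → List ℕ
  coloursAtS xs = map proj₂ (filter (S? ∘ proj₁) xs)

  coloursAtS-∷ : ∀ x past {c} → c ∈ coloursAtS past → c ∈ coloursAtS (x ∷ past)
  coloursAtS-∷ (v , _) past c∈ with S? v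
  ... | yes _ = there c∈
  ... | no _ = c∈

  fresh-colours : ∀ past xs → ValidAcc E past xs →
                  Unique (coloursAtS xs) × All (_∉ coloursAtS past) (coloursAtS xs)
  fresh-colours past [] _ = [] , []
  fresh-colours past ((v , c) ∷ xs) (_ , compatible , valid) with S? v
  ... | yes v∈S =
        All.map (λ c'∉ c≡c' → c'∉ (subst (_∈ coloursAtS ((v , c) ∷ past)) c≡c' c∈)) fresh
          ∷ unique
      , c∉past ∷ All.map (λ c'∉ c'∈ → c'∉ (coloursAtS-∷ (v , c) past c'∈)) fresh
    where
    unique : Unique (coloursAtS xs)
    unique = proj₁ (fresh-colours ((v , c) ∷ past) xs valid)
    fresh : All (_∉ coloursAtS ((v , c) ∷ past)) (coloursAtS xs)
    fresh = proj₂ (fresh-colours ((v , c) ∷ past) xs valid)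
    c∈ : c ∈ coloursAtS ((v , c) ∷ past)
    c∈ with S? v
    ... | yes _ = here refl
    ... | no v∉S = ⊥-elim (v∉S v∈S)
    c∉past : c ∉ coloursAtS past
    c∉past c∈past with ∈.∈-map∘filter⁻ proj₂ (S? ∘ proj₁) c∈past
    ... | ((u , d) , ud∈ , refl , u∈S) = All.lookup compatible ud∈ (clique v u v∈S u∈S) refl
  ... | no _ with fresh-colours ((v , c) ∷ past) xs valid
  ...   | (unique , fresh) = unique , All.map (λ c'∉ c'∈ → c'∉ (coloursAtS-∷ (v , c) past c'∈)) fresh

  clique-bound : ∀ I cs → OfflineColoring E I cs → countBy S? I ≤ numColors cs
  clique-bound I cs (same-length , valid) = subst (_≤ numColors cs) requests≡colours
    (unique⊆⇒length≤ _≟_ (proj₁ (fresh-colours [] (zip I cs) valid)) coloursAtS⊆cs)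
    where
    requests≡colours : length (coloursAtS (zip I cs)) ≡ countBy S? I
    requests≡colours = begin
      length (coloursAtS (zip I cs))            ≡⟨ List.length-map proj₂ (filter (S? ∘ proj₁) (zip I cs)) ⟩
      length (filter (S? ∘ proj₁) (zip I cs))   ≡⟨ countBy-map S? proj₁ (zip I cs) ⟩
      countBy S? (map proj₁ (zip I cs))         ≡⟨ cong (countBy S?) (map-proj₁-zip I cs same-length) ⟩
      countBy S? I                              ∎
      where open ≡-Reasoning
    coloursAtS⊆cs : ∀ {c} → c ∈ coloursAtS (zip I cs) → c ∈ deduplicate _≟_ cs
    coloursAtS⊆cs c∈ with ∈.∈-map∘filter⁻ proj₂ (S? ∘ proj₁) c∈
    ... | (x , x∈ , refl , _) =
          ∈.∈-deduplicate⁺ _≟_ (subst (proj₂ x ∈_) (map-proj₂-zip I cs same-length) (∈.∈-map⁺ proj₂ x∈))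

maxOver : (n : ℕ) → (Fin n → ℕ) → ℕ
maxOver zero f = 0
maxOver (suc n) f = f Fin.zero ⊔ maxOver n (f ∘ Fin.suc)

≤-maxOver : ∀ n (f : Fin n → ℕ) i → f i ≤ maxOver n f
≤-maxOver (suc n) f Fin.zero = m≤m⊔n _ _
≤-maxOver (suc n) f (Fin.suc i) = ≤-trans (≤-maxOver n (f ∘ Fin.suc) i) (m≤n⊔m _ _)

maxOver-≤ : ∀ n (f : Fin n → ℕ) {k} → (∀ i → f i ≤ k) → maxOver n f ≤ k
maxOver-≤ zero f _ = z≤n
maxOver-≤ (suc n) f f≤k = ⊔-lub (f≤k Fin.zero) (maxOver-≤ n (f ∘ Fin.suc) (f≤k ∘ Fin.suc))

-- The maximum load of I: the largest number of requests made to a single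
-- node or to the two ends of an edge.  By the clique bound it is a lower
-- bound on Opt (for bipartite graphs it is Opt itself).
module MaxLoad {n : ℕ} (E : Adj n) (I : List (Fin n)) where

  InPair : Fin n → Fin n → Fin n → Set
  InPair a b w = w ≡ a ⊎ w ≡ b

  inPair? : ∀ a b → Decidable (InPair a b)
  inPair? a b w = (w ≟ᶠ a) ⊎-dec (w ≟ᶠ b)

  count-inPair-self : ∀ a xs → countBy (inPair? a a) xs ≡ count a xs
  count-inPair-self a [] = refl
  count-inPair-self a (w ∷ xs) with w ≟ᶠ a
  ... | yes _ = cong suc (count-inPair-self a xs)
  ... | no _ = count-inPair-self a xs

  count-inPair : ∀ a b → a ≢ b → ∀ xs → countBy (inPair? a b) xs ≡ count a xs + count b xs
  count-inPair a b a≢b [] = refl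
  count-inPair a b a≢b (w ∷ xs) with w ≟ᶠ a | w ≟ᶠ b
  ... | yes refl | yes refl = ⊥-elim (a≢b refl)
  ... | yes _ | no _ = cong suc (count-inPair a b a≢b xs)
  ... | no _ | yes _ = trans (cong suc (count-inPair a b a≢b xs)) (sym (+-suc _ _))
  ... | no _ | no _ = count-inPair a b a≢b xs

  loadOf : ∀ {a b} → Dec (Conflict E a b) → ℕ
  loadOf {a} {b} (yes _) = countBy (inPair? a b) I
  loadOf (no _) = 0

  load : Fin n → Fin n → ℕ
  load a b = loadOf (conflict? E a b)

  maxLoad : ℕ
  maxLoad = maxOver n (λ a → maxOver n (load a))

  conflicting≤maxLoad : ∀ a b → Conflict E a b → countBy (inPair? a b) I ≤ maxLoad
  conflicting≤maxLoad a b ab = ≤-trans (loadOf-conflict (conflict? E a b))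
    (≤-trans (≤-maxOver n (load a) b) (≤-maxOver n (λ a → maxOver n (load a)) a))
    where
    loadOf-conflict : (d : Dec (Conflict E a b)) → countBy (inPair? a b) I ≤ loadOf d
    loadOf-conflict (yes _) = ≤-refl
    loadOf-conflict (no ¬ab) = ⊥-elim (¬ab ab)

  count≤maxLoad : ∀ v → count v I ≤ maxLoad
  count≤maxLoad v = subst (_≤ maxLoad) (count-inPair-self v I) (conflicting≤maxLoad v v (inj₁ refl))

  edge-count≤maxLoad : SimpleGraph n E → ∀ u v → E u v ≡ true → count u I + count v I ≤ maxLoad
  edge-count≤maxLoad (_ , loopless) u v uv =
    subst (_≤ maxLoad) (count-inPair u v u≢v I) (conflicting≤maxLoad u v (inj₂ uv))
    where
    u≢v : u ≢ v
    u≢v refl = loopless u uv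

  maxLoad≤Opt : SimpleGraph n E → ∀ k → IsOpt E I k → maxLoad ≤ k
  maxLoad≤Opt (symmetric , _) k ((cs , colouring , cs-uses-k) , _) =
    maxOver-≤ n _ (λ a → maxOver-≤ n _ (λ b → load≤k a b (conflict? E a b)))
    where
    load≤k : ∀ a b (d : Dec (Conflict E a b)) → loadOf d ≤ k
    load≤k a b (no _) = z≤n
    load≤k a b (yes ab) = subst (countBy (inPair? a b) I ≤_) cs-uses-k
      (CliqueBound.clique-bound E (inPair? a b) pair-clique I cs colouring)
      where
      pair-clique : ∀ x y → InPair a b x → InPair a b y → Conflict E x y
      pair-clique x y (inj₁ refl) (inj₁ refl) = inj₁ refl
      pair-clique x y (inj₂ refl) (inj₂ refl) = inj₁ refl
      pair-clique x y (inj₁ refl) (inj₂ refl) = ab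
      pair-clique x y (inj₂ refl) (inj₁ refl) = conflict-sym symmetric ab

ProperSides : {n : ℕ} → Adj n → (Fin n → Bool) → Set
ProperSides E side = ∀ u v → E u v ≡ true → side u ≢ side v

properSides? : {n : ℕ} (E : Adj n) (s : Subset n) → Dec (ProperSides E (lookup s))
properSides? E s = all? λ u → all? λ v → (E u v ≟ᵇ true) →-dec ¬? (lookup s u ≟ᵇ lookup s v)

-- The algorithm computes a bipartition by exhaustive search over all
-- subsets of the nodes (it knows the graph in advance).
findSides : (n : ℕ) → Adj n → Fin n → Bool
findSides n E with anySubset? (properSides? E)
... | yes (s , _) = lookup s
... | no _ = λ _ → true

findSides-proper : ∀ n (E : Adj n) → Bipartite n E → ProperSides E (findSides n E)
findSides-proper n E (side , proper) with anySubset? (properSides? E)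
... | yes (_ , found) = found
... | no none = ⊥-elim (none (tabulate side , tabulated))
  where
  tabulated : ProperSides E (lookup (tabulate side))
  tabulated u v uv rewrite lookup∘tabulate side u | lookup∘tabulate side v = proper u v uv

-- Prefix decoders in continuation-passing style: a decoder reads a prefix
-- of its input and passes the decoded value and the remaining input to its
-- continuation; it returns nothing when the input ends too early.
Decoder : Set → Set₁
Decoder A = {B : Set} → (A → List Bool → Maybe B) → List Bool → Maybe B

pureD : {A : Set} → A → Decoder A
pureD a k = k a

mapD : {A A′ : Set} → (A → A′) → Decoder A → Decoder A′
mapD f d k = d (λ a → k (f a))

_>>=D_ : {A A′ : Set} → Decoder A → (A → Decoder A′) → Decoder A′
(d >>=D f) k = d (λ a → f a k)

bitD : Decoder Bool
bitD k [] = nothing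
bitD k (b ∷ rest) = k b rest

unaryD : Decoder ℕ
unaryD k [] = nothing
unaryD k (false ∷ rest) = k 0 rest
unaryD k (true ∷ rest) = unaryD (λ m → k (suc m)) rest

bit : Bool → ℕ
bit true = 1
bit false = 0

bitsD : ℕ → Decoder ℕ
bitsD zero = pureD 0
bitsD (suc L) = bitD >>=D λ b → mapD (λ v → bit b + 2 * v) (bitsD L)

record Exact {A : Set} (d : Decoder A) (w : List Bool) (a : A) : Set₁ where
  field
    complete : ∀ {B} (k : A → List Bool → Maybe B) xs → d k (w ++ xs) ≡ k a xs
    incomplete : ∀ {B} (k : A → List Bool → Maybe B) p → p < length w → d k (take p w) ≡ nothing
open Exact

take-++ˡ : {A : Set} (p : ℕ) (w xs : List A) → p ≤ length w → take p (w ++ xs) ≡ take p w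
take-++ˡ zero w xs _ = refl
take-++ˡ (suc p) (b ∷ w) xs (s≤s p≤w) = cong (b ∷_) (take-++ˡ p w xs p≤w)

take-++ʳ : {A : Set} (w xs : List A) (q : ℕ) → take (length w + q) (w ++ xs) ≡ w ++ take q xs
take-++ʳ [] xs q = refl
take-++ʳ (b ∷ w) xs q = cong (b ∷_) (take-++ʳ w xs q)

exact-pure : {A : Set} (a : A) → Exact (pureD a) [] a
exact-pure a = record { complete = λ k xs → refl ; incomplete = λ k p () }

exact-map : {A A′ : Set} (f : A → A′) {d : Decoder A} {w : List Bool} {a : A} →
            Exact d w a → Exact (mapD f d) w (f a)
exact-map f e = record
  { complete = λ k → complete e (λ a → k (f a))
  ; incomplete = λ k → incomplete e (λ a → k (f a)) }

exact-bind : {A A′ : Set} {d : Decoder A} {f : A → Decoder A′} {w w′ : List Bool} {a : A} {a′ : A′} →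
             Exact d w a → Exact (f a) w′ a′ → Exact (d >>=D f) (w ++ w′) a′
exact-bind {d = d} {f} {w} {w′} {a} {a′} e e′ = record { complete = full ; incomplete = partial }
  where
  full : ∀ {B} (k : _ → List Bool → Maybe B) xs → (d >>=D f) k ((w ++ w′) ++ xs) ≡ k a′ xs
  full k xs = begin
    d (λ a → f a k) ((w ++ w′) ++ xs)  ≡⟨ cong (d (λ a → f a k)) (List.++-assoc w w′ xs) ⟩
    d (λ a → f a k) (w ++ (w′ ++ xs))  ≡⟨ complete e (λ a → f a k) (w′ ++ xs) ⟩
    f a k (w′ ++ xs)                   ≡⟨ complete e′ k xs ⟩
    k a′ xs                            ∎
    where open ≡-Reasoning
  -- a proper prefix of w ++ w′ is a proper prefix of w, or w followed by a
  -- proper prefix of w′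
  partial : ∀ {B} (k : _ → List Bool → Maybe B) p → p < length (w ++ w′) → (d >>=D f) k (take p (w ++ w′)) ≡ nothing
  partial k p p<ww′ with p <? length w
  ... | yes p<w = trans (cong (d (λ a → f a k)) (take-++ˡ p w w′ (<⇒≤ p<w))) (incomplete e (λ a → f a k) p p<w)
  ... | no p≮w with m≤n⇒∃[o]m+o≡n (≮⇒≥ p≮w)
  ...   | (q , refl) = trans (cong (d (λ a → f a k)) (take-++ʳ w w′ q))
                         (trans (complete e (λ a → f a k) (take q w′)) (incomplete e′ k q q<w′))
    where
    q<w′ : q < length w′
    q<w′ = +-cancelˡ-< (length w) q (length w′) (subst (length w + q <_) (List.length-++ w) p<ww′)

exact-bit : (b : Bool) → Exact bitD (b ∷ []) b
exact-bit b = record { complete = λ k xs → refl ; incomplete = λ { k zero _ → refl ; k (suc p) (s≤s ()) } }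

unaryCode : ℕ → List Bool
unaryCode m = replicate m true ++ false ∷ []

exact-unary : ∀ m → Exact unaryD (unaryCode m) m
exact-unary m = record { complete = full m ; incomplete = partial m }
  where
  full : ∀ m {B} (k : ℕ → List Bool → Maybe B) xs → unaryD k (unaryCode m ++ xs) ≡ k m xs
  full zero k xs = refl
  full (suc m) k xs = full m (λ m → k (suc m)) xs
  partial : ∀ m {B} (k : ℕ → List Bool → Maybe B) p → p < length (unaryCode m) → unaryD k (take p (unaryCode m)) ≡ nothing
  partial m k zero _ = refl
  partial zero k (suc p) (s≤s ())
  partial (suc m) k (suc p) (s≤s p<m) = partial m (λ m → k (suc m)) p p<m

halve : ℕ → Bool × ℕ
halve zero = false , 0
halve (suc zero) = true , 0
halve (suc (suc n)) = proj₁ (halve n) , suc (proj₂ (halve n))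

halve-correct : ∀ n → bit (proj₁ (halve n)) + 2 * proj₂ (halve n) ≡ n
halve-correct zero = refl
halve-correct (suc zero) = refl
halve-correct (suc (suc n)) = begin
  bit b + 2 * suc q      ≡⟨ cong (bit b +_) (*-suc 2 q) ⟩
  bit b + (2 + 2 * q)    ≡⟨ +-comm (bit b) (2 + 2 * q) ⟩
  2 + 2 * q + bit b      ≡⟨ cong (2 +_) (+-comm (2 * q) (bit b)) ⟩
  2 + (bit b + 2 * q)    ≡⟨ cong (2 +_) (halve-correct n) ⟩
  suc (suc n)            ∎
  where
  open ≡-Reasoning
  b : Bool
  b = proj₁ (halve n)
  q : ℕ
  q = proj₂ (halve n)

toBits : ℕ → ℕ → List Bool
toBits zero e = []
toBits (suc L) e = proj₁ (halve e) ∷ toBits L (proj₂ (halve e))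

length-toBits : ∀ L e → length (toBits L e) ≡ L
length-toBits zero e = refl
length-toBits (suc L) e = cong suc (length-toBits L (proj₂ (halve e)))

exact-bits : ∀ L e → e < 2 ^ L → Exact (bitsD L) (toBits L e) e
exact-bits zero zero _ = exact-pure 0
exact-bits zero (suc e) (s≤s ())
exact-bits (suc L) e e<2^1+L = subst (Exact (bitsD (suc L)) (toBits (suc L) e)) (halve-correct e)
  (exact-bind (exact-bit b) (exact-map (λ v → bit b + 2 * v) (exact-bits L q q<2^L)))
  where
  b : Bool
  b = proj₁ (halve e)
  q : ℕ
  q = proj₂ (halve e)
  q<2^L : q < 2 ^ L
  q<2^L = *-cancelˡ-< 2 q (2 ^ L) (begin-strict
    2 * q            ≤⟨ m≤n+m (2 * q) (bit b) ⟩
    bit b + 2 * q    ≡⟨ halve-correct e ⟩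
    e                <⟨ e<2^1+L ⟩
    2 ^ suc L        ∎)
    where open ≤-Reasoning

-- Its length is O(L + m), so with
-- L ≈ log e it encodes a number near K in O(log log K) bits.
codeword : ℕ → ℕ → ℕ → List Bool
codeword L e m = unaryCode L ++ (toBits L e ++ unaryCode m)

codeD : Decoder ℕ
codeD = unaryD >>=D λ L → bitsD L >>=D λ e → mapD (λ m → m * 2 ^ e) unaryD

exact-codeword : ∀ L e m → e < 2 ^ L → Exact codeD (codeword L e m) (m * 2 ^ e)
exact-codeword L e m e<2^L =
  exact-bind (exact-unary L) (exact-bind (exact-bits L e e<2^L) (exact-map (λ m → m * 2 ^ e) (exact-unary m)))

length-codeword : ∀ L e m → length (codeword L e m) ≡ 2 * L + m + 2
length-codeword L e m = begin
  length (unaryCode L ++ (toBits L e ++ unaryCode m))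
    ≡⟨ List.length-++ (unaryCode L) ⟩
  length (unaryCode L) + length (toBits L e ++ unaryCode m)
    ≡⟨ cong (length (unaryCode L) +_) (List.length-++ (toBits L e)) ⟩
  length (unaryCode L) + (length (toBits L e) + length (unaryCode m))
    ≡⟨ cong₂ (λ x y → x + (y + length (unaryCode m))) (length-unaryCode L) (length-toBits L e) ⟩
  suc L + (L + length (unaryCode m))
    ≡⟨ cong (λ x → suc L + (L + x)) (length-unaryCode m) ⟩
  suc L + (L + suc m)
    ≡⟨ rearrange L m ⟩
  2 * L + m + 2 ∎
  where
  open ≡-Reasoning
  rearrange : ∀ L m → suc L + (L + suc m) ≡ 2 * L + m + 2
  rearrange = solve-∀
  length-unaryCode : ∀ m → length (unaryCode m) ≡ suc m
  length-unaryCode m = trans (List.length-++ (replicate m true)) (trans (cong (_+ 1) (List.length-replicate m)) (+-comm m 1))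

decode : List Bool → Maybe ℕ
decode = codeD (λ M _ → just M)

mapR : {A B : Set} → (A → B) → Reader A → Reader B
mapR f (done a) = done (f a)
mapR f (read next) = read (λ b → mapR f (next b))

runReader-mapR : {A B : Set} (f : A → B) (r : Reader A) (t : ℕ → Bool) (p : ℕ) →
                 runReader (mapR f r) t p ≡ (f (proj₁ (runReader r t p)) , proj₂ (runReader r t p))
runReader-mapR f (done a) t p = refl
runReader-mapR f (read next) t p = runReader-mapR f (next (t p)) t (suc p)

readAdvice : ℕ → List Bool → Reader (List Bool)
readAdvice zero bits = done bits
readAdvice (suc fuel) bits with decode bits
... | just _ = done bits
... | nothing = read (λ b → readAdvice fuel (bits ++ b ∷ []))

budget : {A : Set} → ℕ → List A → ℕ
budget H [] = H
budget H (_ ∷ _) = 1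

-- Colours once the bound M is known, offset by R: the j-th request to a
-- node gets colour R + j on side true and R + (M + 1 - j) on side false, so
-- the two sides fill the block R+1 … R+M from opposite ends.
palette : Bool → ℕ → ℕ → ℕ → ℕ
palette true R M j = R + j
palette false R M j = R + suc (M ∸ j)

History : ℕ → Set
History n = List (Fin n × ℕ)

nodes : {n : ℕ} → History n → List (Fin n)
nodes = map proj₁

-- Before the codeword is complete, the request served after the history h
-- gets the fresh colour length h + 1; afterwards colours come from the
-- palette, offset by the number (length of codeword ∸ H) of fresh colours.
colourFor : {n : ℕ} → ℕ → (Fin n → Bool) → History n → Fin n → List Bool → ℕ
colourFor H side h v bits with decode bits
... | just M = palette (side v) (length bits ∸ H) M (suc (count v (nodes h)))
... | nothing = suc (length h)

algorithm : ℕ → OnlineAlg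
algorithm H n E bits h v = mapR (colourFor H (findSides n E) h v) (readAdvice (budget H h) bits)

valid-snoc : {n : ℕ} (E : Adj n) (past xs : List (Fin n × ℕ)) (x : Fin n × ℕ) →
             ValidAcc E past xs → 1 ≤ proj₂ x →
             (∀ {z} → z ∈ xs ⊎ z ∈ past → Compatible E x z) → ValidAcc E past (xs ++ x ∷ [])
valid-snoc E past [] x _ positive compatible = positive , All.tabulate (compatible ∘ inj₂) , tt
valid-snoc E past (y ∷ ys) x (y-positive , y-compatible , valid) positive compatible =
  y-positive , y-compatible , valid-snoc E (y ∷ past) ys x valid positive (compatible ∘ shift)
  where
  shift : ∀ {z} → z ∈ ys ⊎ z ∈ y ∷ past → z ∈ y ∷ ys ⊎ z ∈ past
  shift (inj₁ z∈ys) = inj₁ (there z∈ys)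
  shift (inj₂ (here z≡y)) = inj₁ (here z≡y)
  shift (inj₂ (there z∈past)) = inj₂ z∈past

R<palette : ∀ s R M j → 1 ≤ j → R < palette s R M j
R<palette true R M j 1≤j = subst (_≤ R + j) (+-comm R 1) (+-monoʳ-≤ R 1≤j)
R<palette false R M j 1≤j = m<m+n R (s≤s z≤n)

palette≤R+M : ∀ s R M j → 1 ≤ j → j ≤ M → palette s R M j ≤ R + M
palette≤R+M true R M j 1≤j j≤M = +-monoʳ-≤ R j≤M
palette≤R+M false R M j 1≤j j≤M = +-monoʳ-≤ R (∸-monoʳ-< 1≤j j≤M)

palette-injective : ∀ s R M {a b} → b < a → a ≤ M → palette s R M a ≢ palette s R M b
palette-injective true R M b<a _ eq = <-irrefl (sym (+-cancelˡ-≡ R _ _ eq)) b<a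
palette-injective false R M b<a a≤M eq =
  <-irrefl (sym (∸-cancelˡ-≡ a≤M (≤-trans (<⇒≤ b<a) a≤M) (suc-injective (+-cancelˡ-≡ R _ _ eq)))) b<a

palette-sides : ∀ {s₁ s₂} R M {a b} → s₁ ≢ s₂ → a + b ≤ M → palette s₁ R M a ≢ palette s₂ R M b
palette-sides {true} {true} R M s₁≢s₂ _ _ = s₁≢s₂ refl
palette-sides {false} {false} R M s₁≢s₂ _ _ = s₁≢s₂ refl
palette-sides {true} {false} R M {a} {b} _ a+b≤M eq = <-irrefl refl (begin-strict
  M                      ≡⟨ sym (m∸n+n≡m (≤-trans (m≤n+m b a) a+b≤M)) ⟩
  M ∸ b + b              <⟨ n<1+n _ ⟩
  suc (M ∸ b) + b        ≡⟨ cong (_+ b) (sym (+-cancelˡ-≡ R _ _ eq)) ⟩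
  a + b                  ≤⟨ a+b≤M ⟩
  M                      ∎)
  where open ≤-Reasoning
palette-sides {false} {true} R M {a} {b} s₁≢s₂ a+b≤M eq =
  palette-sides R M (s₁≢s₂ ∘ sym) (subst (_≤ M) (+-comm a b) a+b≤M) (sym eq)

-- The colouring the algorithm produces once the advice is fixed: the
-- codeword for M has length ℓ and becomes complete while serving the
-- request number i exactly when ℓ ≤ H + i.
module Schedule {n : ℕ} (side : Fin n → Bool) (H ℓ M : ℕ) where

  -- the number of fresh colours used before the codeword is complete
  R : ℕ
  R = ℓ ∸ H

  colourAt : (h : History n) → Fin n → Dec (ℓ ≤ H + length h) → ℕ
  colourAt h v (yes _) = palette (side v) R M (suc (count v (nodes h)))
  colourAt h v (no _) = suc (length h)

  colour : History n → Fin n → ℕ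
  colour h v = colourAt h v (ℓ ≤? H + length h)

  serve : History n → Fin n → History n
  serve h v = h ++ (v , colour h v) ∷ []

  schedule : List (Fin n) → History n → History n
  schedule [] h = h
  schedule (v ∷ vs) h = schedule vs (serve h v)

  data Scheduled : History n → Set where
    start : Scheduled []
    _▷_ : ∀ {h} → Scheduled h → ∀ v → Scheduled (serve h v)

  prefix-of : ∀ {h} → Scheduled h → ∀ {z} → z ∈ h →
              ∃₂ λ h₀ h₁ → h ≡ h₀ ++ z ∷ h₁ × proj₂ z ≡ colour h₀ (proj₁ z)
  prefix-of start ()
  prefix-of (_▷_ {h} scheduled v) z∈ with ∈.∈-++⁻ h z∈
  ... | inj₁ z∈h with prefix-of scheduled z∈h
  ...   | (h₀ , h₁ , refl , coloured) = h₀ , h₁ ++ (v , colour h v) ∷ [] , List.++-assoc h₀ _ _ , coloured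
  prefix-of (_▷_ {h} scheduled v) z∈ | inj₂ (here refl) = h , [] , refl , refl

  fresh≤R : (h : History n) → ¬ (ℓ ≤ H + length h) → suc (length h) ≤ R
  fresh≤R h ℓ≰ = m+n≤o⇒m≤o∸n (suc (length h)) (subst (_≤ ℓ) (cong suc (+-comm H (length h))) (≰⇒> ℓ≰))

  module Correctness (E : Adj n) (I : List (Fin n)) (proper : ProperSides E side)
                     (vertex-load : ∀ v → count v I ≤ M)
                     (edge-load : ∀ u v → E u v ≡ true → count u I + count v I ≤ M) where

    colours-differ : ∀ h₀ h v u → length h₀ < length h →
      count u (nodes h₀) < count u (nodes h) → count u (nodes h) ≤ count u I → count v (nodes h) < count v I →
      (d₀ : Dec (ℓ ≤ H + length h₀)) (d : Dec (ℓ ≤ H + length h)) →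
      Conflict E v u → colourAt h v d ≢ colourAt h₀ u d₀
    colours-differ h₀ h v u h₀<h _ _ _ (no _) (no _) _ eq = <-irrefl (sym (suc-injective eq)) h₀<h
    colours-differ h₀ h v u h₀<h _ _ _ (yes ℓ≤) (no ℓ≰) _ _ = ℓ≰ (≤-trans ℓ≤ (+-monoʳ-≤ H (<⇒≤ h₀<h)))
    colours-differ h₀ h v u h₀<h _ _ _ (no ℓ≰) (yes _) _ eq =
      <-irrefl (sym eq) (<-≤-trans (s≤s (fresh≤R h₀ ℓ≰)) (R<palette (side v) R M _ (s≤s z≤n)))
    colours-differ h₀ h v u h₀<h u-earlier _ v-later (yes _) (yes _) (inj₁ refl) =
      palette-injective (side v) R M (s≤s u-earlier) (≤-trans v-later (vertex-load v))
    colours-differ h₀ h v u h₀<h u-earlier u-in-I v-later (yes _) (yes _) (inj₂ vu) =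
      palette-sides R M (proper v u vu)
        (≤-trans (+-mono-≤ v-later (≤-trans u-earlier u-in-I)) (edge-load v u vu))

    nodes-++ : (h₀ : History n) (z : Fin n × ℕ) (h₁ : History n) → nodes (h₀ ++ z ∷ h₁) ≡ nodes h₀ ++ proj₁ z ∷ nodes h₁
    nodes-++ h₀ z h₁ = List.map-++ proj₁ h₀ (z ∷ h₁)

    compatible : ∀ h v rest → Scheduled h → nodes h ++ v ∷ rest ≡ I → ∀ {z} → z ∈ h → Compatible E (v , colour h v) z
    compatible h v rest scheduled h-prefix {u , _} z∈h with prefix-of scheduled z∈h
    ... | (h₀ , h₁ , refl , refl) = colours-differ h₀ h v u h₀<h u-earlier u-in-I v-later (ℓ ≤? H + length h₀) (ℓ ≤? H + length h)
      where
      h₀<h : length h₀ < length h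
      h₀<h = subst (length h₀ <_) (sym (List.length-++ h₀)) (m<m+n (length h₀) (s≤s z≤n))
      u-earlier : count u (nodes h₀) < count u (nodes h)
      u-earlier = subst (count u (nodes h₀) <_) (cong (count u) (sym (nodes-++ h₀ _ h₁)))
                    (count-<-occurrence u (nodes h₀) (nodes h₁))
      u-in-I : count u (nodes h) ≤ count u I
      u-in-I = subst (count u (nodes h) ≤_) (cong (count u) h-prefix) (count-++ˡ u (nodes h) (v ∷ rest))
      v-later : count v (nodes h) < count v I
      v-later = subst (count v (nodes h) <_) (cong (count v) h-prefix) (count-<-occurrence v (nodes h) rest)

    colour-positive : ∀ h v (d : Dec (ℓ ≤ H + length h)) → 1 ≤ colourAt h v d
    colour-positive h v (yes _) = <-≤-trans (s≤s z≤n) (R<palette (side v) R M _ (s≤s z≤n))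
    colour-positive h v (no _) = s≤s z≤n

    schedule-valid : ∀ vs h → Scheduled h → ValidAcc E [] h → nodes h ++ vs ≡ I →
                     ValidAcc E [] (schedule vs h) × Scheduled (schedule vs h) × nodes (schedule vs h) ≡ I
    schedule-valid [] h scheduled valid h≡I = valid , scheduled , trans (sym (List.++-identityʳ (nodes h))) h≡I
    schedule-valid (v ∷ vs) h scheduled valid h-prefix =
      schedule-valid vs (serve h v) (scheduled ▷ v)
        (valid-snoc E [] h (v , colour h v) valid (colour-positive h v (ℓ ≤? H + length h)) new-compatible)
        (begin
          nodes (serve h v) ++ vs          ≡⟨ cong (_++ vs) (List.map-++ proj₁ h ((v , colour h v) ∷ [])) ⟩
          (nodes h ++ v ∷ []) ++ vs        ≡⟨ List.++-assoc (nodes h) (v ∷ []) vs ⟩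
          nodes h ++ v ∷ vs                ≡⟨ h-prefix ⟩
          I                                ∎)
      where
      open ≡-Reasoning
      new-compatible : ∀ {z} → z ∈ h ⊎ z ∈ [] → Compatible E (v , colour h v) z
      new-compatible (inj₁ z∈h) = compatible h v vs scheduled h-prefix z∈h

    colour-≤ : ∀ h u → suc (count u (nodes h)) ≤ M → (d : Dec (ℓ ≤ H + length h)) → colourAt h u d ≤ R + M
    colour-≤ h u u-load (yes _) = palette≤R+M (side u) R M _ (s≤s z≤n) u-load
    colour-≤ h u u-load (no ℓ≰) = ≤-trans (fresh≤R h ℓ≰) (m≤m+n R M)

    entry-range : ∀ h → Scheduled h → nodes h ≡ I → ∀ {z} → z ∈ h → 1 ≤ proj₂ z × proj₂ z ≤ R + M
    entry-range h scheduled h≡I {u , _} z∈h with prefix-of scheduled z∈h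
    ... | (h₀ , h₁ , refl , refl) =
      colour-positive h₀ u (ℓ ≤? H + length h₀) , colour-≤ h₀ u u-load (ℓ ≤? H + length h₀)
      where
      u-load : suc (count u (nodes h₀)) ≤ M
      u-load = ≤-trans (count-<-occurrence u (nodes h₀) (nodes h₁))
        (≤-trans (≤-reflexive (cong (count u) (trans (sym (nodes-++ h₀ _ h₁)) h≡I))) (vertex-load u))

    numColors-≤ : ∀ h → Scheduled h → nodes h ≡ I → numColors (map proj₂ h) ≤ R + M
    numColors-≤ h scheduled h≡I = subst (numColors (map proj₂ h) ≤_) (List.length-applyUpTo suc (R + M))
      (unique⊆⇒length≤ _≟_ (Unique.deduplicate-! _≟_ (map proj₂ h)) in-range)
      where
      in-range : ∀ {c} → c ∈ deduplicate _≟_ (map proj₂ h) → c ∈ applyUpTo suc (R + M)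
      in-range c∈ with ∈.∈-map⁻ proj₂ (∈.∈-deduplicate⁻ _≟_ (map proj₂ h) c∈)
      ... | (z , z∈h , refl) with proj₂ z | entry-range h scheduled h≡I z∈h
      ...   | suc c | (_ , c<R+M) = ∈.∈-applyUpTo⁺ suc c<R+M

    schedule-correct : Valid E (schedule I []) × numColors (map proj₂ (schedule I [])) ≤ R + M
    schedule-correct with schedule-valid I [] start tt refl
    ... | (valid , scheduled , nodes≡I) = valid , numColors-≤ (schedule I []) scheduled nodes≡I

tapeOf : List Bool → ℕ → Bool
tapeOf [] i = false
tapeOf (b ∷ w) zero = b
tapeOf (b ∷ w) (suc i) = tapeOf w i

bits-of-tape : ∀ w p → p ≤ length w → map (tapeOf w) (upTo p) ≡ take p w
bits-of-tape w p p≤w = trans (List.map-applyUpTo (λ i → i) (tapeOf w) p) (applyUpTo-tape w p p≤w)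
  where
  applyUpTo-tape : ∀ w p → p ≤ length w → applyUpTo (tapeOf w) p ≡ take p w
  applyUpTo-tape w zero _ = refl
  applyUpTo-tape (b ∷ w) (suc p) (s≤s p≤w) = cong (b ∷_) (applyUpTo-tape w p p≤w)

take-suc-tape : ∀ (w : List Bool) p → p < length w → take p w ++ tapeOf w p ∷ [] ≡ take (suc p) w
take-suc-tape (b ∷ w) zero _ = refl
take-suc-tape (b ∷ w) (suc p) (s≤s p<w) = cong (b ∷_) (take-suc-tape w p p<w)

module Run (H : ℕ) (cd : List Bool) (M : ℕ) (exact : Exact codeD cd M) where

  ℓ : ℕ
  ℓ = length cd

  t : ℕ → Bool
  t = tapeOf cd

  take-ℓ : take ℓ cd ≡ cd
  take-ℓ = List.take-all ℓ cd ≤-refl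

  decode-complete : decode cd ≡ just M
  decode-complete = trans (cong decode (sym (List.++-identityʳ cd))) (Exact.complete exact (λ M _ → just M) [])

  decode-incomplete : ∀ p → p < ℓ → decode (take p cd) ≡ nothing
  decode-incomplete = Exact.incomplete exact (λ M _ → just M)

  readAdvice-run : ∀ f p → p ≤ ℓ → runReader (readAdvice f (take p cd)) t p ≡ (take (ℓ ⊓ (p + f)) cd , ℓ ⊓ (p + f))
  readAdvice-run zero p p≤ℓ rewrite +-identityʳ p | m≥n⇒m⊓n≡n p≤ℓ = refl
  readAdvice-run (suc f) p p≤ℓ with m≤n⇒m<n∨m≡n p≤ℓ
  ... | inj₁ p<ℓ rewrite decode-incomplete p p<ℓ | take-suc-tape cd p p<ℓ | +-suc p f = readAdvice-run f (suc p) p<ℓ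
  ... | inj₂ refl rewrite take-ℓ | decode-complete | m≤n⇒m⊓n≡m (m≤m+n ℓ (suc f)) | take-ℓ = refl

  -- advice position after serving i requests
  position : ℕ → ℕ
  position zero = 0
  position (suc i) = ℓ ⊓ (H + i)

  position≤ℓ : ∀ i → position i ≤ ℓ
  position≤ℓ zero = z≤n
  position≤ℓ (suc i) = m⊓n≤m ℓ (H + i)

  position-step : ∀ {A : Set} (h : List A) → ℓ ⊓ (position (length h) + budget H h) ≡ position (suc (length h))
  position-step [] = cong (ℓ ⊓_) (sym (+-identityʳ H))
  position-step (_ ∷ h) = trans (⊓-step (H + length h))
    (cong (ℓ ⊓_) (trans (+-assoc H (length h) 1) (cong (H +_) (+-comm (length h) 1))))
    where
    ⊓-step : ∀ x → ℓ ⊓ (ℓ ⊓ x + 1) ≡ ℓ ⊓ (x + 1)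
    ⊓-step x with ≤-total ℓ x
    ... | inj₁ ℓ≤x rewrite m≤n⇒m⊓n≡m ℓ≤x =
          trans (m≤n⇒m⊓n≡m (m≤m+n ℓ 1)) (sym (m≤n⇒m⊓n≡m (≤-trans ℓ≤x (m≤m+n x 1))))
    ... | inj₂ x≤ℓ rewrite m≥n⇒m⊓n≡n x≤ℓ = refl

  module _ {n : ℕ} (E : Adj n) where
    open Schedule (findSides n E) H ℓ M

    colourFor-schedule : ∀ h v → colourFor H (findSides n E) h v (take (position (suc (length h))) cd) ≡ colour h v
    colourFor-schedule h v with ℓ ≤? H + length h
    ... | yes ℓ≤ rewrite m≤n⇒m⊓n≡m ℓ≤ | take-ℓ | decode-complete = refl
    ... | no ℓ≰ rewrite m≥n⇒m⊓n≡n (<⇒≤ (≰⇒> ℓ≰)) | decode-incomplete (H + length h) (≰⇒> ℓ≰) = refl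

    serve-request : ∀ h v →
      runReader (algorithm H n E (map t (upTo (position (length h)))) h v) t (position (length h))
        ≡ (colour h v , position (suc (length h)))
    serve-request h v
      rewrite bits-of-tape cd (position (length h)) (position≤ℓ (length h))
            | runReader-mapR (colourFor H (findSides n E) h v)
                (readAdvice (budget H h) (take (position (length h)) cd)) t (position (length h))
            | readAdvice-run (budget H h) (position (length h)) (position≤ℓ (length h))
            | position-step h
            = cong (_, position (suc (length h))) (colourFor-schedule h v)

    run-schedule : ∀ vs h → runFrom (algorithm H) n E t vs (position (length h)) h ≡ (schedule vs h , position (length h + length vs))
    run-schedule [] h = cong (λ i → h , position i) (sym (+-identityʳ (length h)))
    run-schedule (v ∷ vs) h rewrite serve-request h v = begin
      runFrom (algorithm H) n E t vs (position (suc (length h))) (serve h v)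
        ≡⟨ cong (λ i → runFrom (algorithm H) n E t vs (position i) (serve h v)) (sym length-serve) ⟩
      runFrom (algorithm H) n E t vs (position (length (serve h v))) (serve h v)
        ≡⟨ run-schedule vs (serve h v) ⟩
      (schedule vs (serve h v) , position (length (serve h v) + length vs))
        ≡⟨ cong (λ i → schedule vs (serve h v) , position i) (trans (cong (_+ length vs) length-serve) (sym (+-suc (length h) (length vs)))) ⟩
      (schedule vs (serve h v) , position (length h + suc (length vs)))
        ∎
      where
      open ≡-Reasoning
      length-serve : length (serve h v) ≡ suc (length h)
      length-serve = trans (List.length-++ h) (+-comm (length h) 1)

    run-algorithm : ∀ I → output (run (algorithm H) n E t I) ≡ schedule I [] × adviceUsed {n} (run (algorithm H) n E t I) ≤ ℓ
    run-algorithm I rewrite run-schedule I [] = refl , position≤ℓ (length I)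

n≤2^⌈log₂n⌉ : ∀ n → n ≤ 2 ^ ⌈log₂ n ⌉
n≤2^⌈log₂n⌉ n = bound n _
  where
  bound : ∀ n (rec : Acc _<_ n) → n ≤ 2 ^ ⌈log2⌉ n rec
  bound zero _ = z≤n
  bound (suc zero) _ = s≤s z≤n
  bound (suc (suc n)) (acc rs) = begin
    suc (suc n)                 ≤⟨ s≤s (s≤s (n≤⌈n/2⌉+⌈n/2⌉ n)) ⟩
    suc (suc (⌈ n /2⌉ + ⌈ n /2⌉)) ≡⟨ cong suc (sym (+-suc ⌈ n /2⌉ ⌈ n /2⌉)) ⟩
    suc ⌈ n /2⌉ + suc ⌈ n /2⌉     ≤⟨ +-mono-≤ half≤ (≤-trans half≤ (m≤m+n _ 0)) ⟩
    2 ^ suc (⌈log2⌉ (suc ⌈ n /2⌉) _) ∎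
    where
    open ≤-Reasoning
    half≤ : suc ⌈ n /2⌉ ≤ 2 ^ ⌈log2⌉ (suc ⌈ n /2⌉) _
    half≤ = bound (suc ⌈ n /2⌉) _
    n≤⌈n/2⌉+⌈n/2⌉ : ∀ n → n ≤ ⌈ n /2⌉ + ⌈ n /2⌉
    n≤⌈n/2⌉+⌈n/2⌉ n = subst (_≤ ⌈ n /2⌉ + ⌈ n /2⌉) (⌊n/2⌋+⌈n/2⌉≡n n) (+-monoˡ-≤ ⌈ n /2⌉ (⌊n/2⌋≤⌈n/2⌉ n))

⌈log₂⌉-≤ : ∀ {n x} → n ≤ 2 ^ x → ⌈log₂ n ⌉ ≤ x
⌈log₂⌉-≤ {n} {x} n≤2^x = subst (⌈log₂ n ⌉ ≤_) (⌈log₂2^n⌉≡n x) (⌈log₂⌉-mono-≤ n≤2^x)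

≤-⌈log₂⌉ : ∀ {n x} → 2 ^ x ≤ n → x ≤ ⌈log₂ n ⌉
≤-⌈log₂⌉ {n} {x} 2^x≤n = subst (_≤ ⌈log₂ n ⌉) (⌈log₂2^n⌉≡n x) (⌈log₂⌉-mono-≤ 2^x≤n)

n<2^n : ∀ n → n < 2 ^ n
n<2^n zero = s≤s z≤n
n<2^n (suc n) = +-mono-≤-< (m^n>0 2 n) (≤-trans (n<2^n n) (m≤m+n _ 0))

⌈log₂n⌉≤n : ∀ n → ⌈log₂ n ⌉ ≤ n
⌈log₂n⌉≤n n = ⌈log₂⌉-≤ (<⇒≤ (n<2^n n))

linear≤exponential : ∀ a b → ∃ λ t → ∀ D → t ≤ D → a + b * D ≤ 2 ^ D
linear≤exponential a b = 2 * y , from-threshold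
  where
  y : ℕ
  y = suc (a + 2 * b)

  at-threshold : a + b * (2 * y) ≤ 2 ^ (2 * y)
  at-threshold = begin
    a + b * (2 * y)              ≤⟨ +-monoˡ-≤ (b * (2 * y)) (m≤n*m a y) ⟩
    y * a + b * (2 * y)          ≤⟨ m≤m+n _ y ⟩
    y * a + b * (2 * y) + y      ≡⟨ square a b ⟩
    y * y                        ≤⟨ *-mono-≤ (<⇒≤ (n<2^n y)) (<⇒≤ (n<2^n y)) ⟩
    2 ^ y * 2 ^ y                ≡⟨ sym (^-distribˡ-+-* 2 y y) ⟩
    2 ^ (y + y)                  ≡⟨ cong (2 ^_) (cong (y +_) (sym (+-identityʳ y))) ⟩
    2 ^ (2 * y)                  ∎
    where
    open ≤-Reasoning
    square : ∀ a b → suc (a + 2 * b) * a + b * (2 * suc (a + 2 * b)) + suc (a + 2 * b)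
                     ≡ suc (a + 2 * b) * suc (a + 2 * b)
    square = solve-∀

  beyond-threshold : ∀ s → a + b * (2 * y + s) ≤ 2 ^ (2 * y + s)
  beyond-threshold zero = subst (λ D → a + b * D ≤ 2 ^ D) (sym (+-identityʳ (2 * y))) at-threshold
  beyond-threshold (suc s) = subst (λ D → a + b * D ≤ 2 ^ D) (sym (+-suc (2 * y) s)) (begin
    a + b * suc (2 * y + s)            ≡⟨ cong (a +_) (*-suc b (2 * y + s)) ⟩
    a + (b + b * (2 * y + s))          ≡⟨ cong (a +_) (+-comm b _) ⟩
    a + (b * (2 * y + s) + b)          ≡⟨ sym (+-assoc a _ b) ⟩
    a + b * (2 * y + s) + b            ≤⟨ +-mono-≤ (beyond-threshold s) b≤2^D ⟩
    2 ^ (2 * y + s) + 2 ^ (2 * y + s)  ≡⟨ cong (2 ^ (2 * y + s) +_) (sym (+-identityʳ _)) ⟩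
    2 ^ suc (2 * y + s)                ∎)
    where
    open ≤-Reasoning
    b≤2^D : b ≤ 2 ^ (2 * y + s)
    b≤2^D = begin
      b                  ≤⟨ m≤m+n b (b + 0) ⟩
      2 * b              ≤⟨ m≤n+m (2 * b) a ⟩
      a + 2 * b          <⟨ n<1+n _ ⟩
      y                  <⟨ n<2^n y ⟩
      2 ^ y              ≤⟨ ^-monoʳ-≤ 2 (≤-trans (m≤m+n y (y + 0)) (m≤m+n (2 * y) s)) ⟩
      2 ^ (2 * y + s)    ∎

  from-threshold : ∀ D → 2 * y ≤ D → a + b * D ≤ 2 ^ D
  from-threshold D 2y≤D with m≤n⇒∃[o]m+o≡n 2y≤D
  ... | (s , refl) = beyond-threshold s

round-up : ∀ g K .{{_ : NonZero g}} → ∃ λ m → K ≤ m * g × m * g < K + g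
round-up g zero = 0 , z≤n , >-nonZero⁻¹ g
round-up g (suc K) with round-up g K
... | (m , K≤mg , mg<K+g) with suc K ≤? m * g
...   | yes 1+K≤mg = m , 1+K≤mg , <-trans mg<K+g (+-monoˡ-< g (n<1+n K))
...   | no 1+K≰mg = suc m , subst (suc K ≤_) (sym exceeded) (+-monoˡ-≤ K (>-nonZero⁻¹ g)) ,
                    subst (_< suc K + g) (sym exceeded) (subst (_< suc K + g) (+-comm K g) (n<1+n (K + g)))
  where
  -- K is a multiple of g, so the next multiple is K + g
  exceeded : suc m * g ≡ g + K
  exceeded = cong (g +_) (≤-antisym (≤-pred (≰⇒> 1+K≰mg)) K≤mg)

exponent : ∀ N K .{{_ : NonZero N}} → ∃ λ e → (e ≡ 0 ⊎ N * 2 ^ e ≤ K) × K < 2 * N * 2 ^ e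
exponent N K = search K 0 refl (inj₁ refl)
  where
  search : ∀ f e → e + f ≡ K → (e ≡ 0 ⊎ N * 2 ^ e ≤ K) → ∃ λ e′ → (e′ ≡ 0 ⊎ N * 2 ^ e′ ≤ K) × K < 2 * N * 2 ^ e′
  search zero e e≡K low = e , low , subst (_< 2 * N * 2 ^ e) (trans (sym (+-identityʳ e)) e≡K)
    (<-≤-trans (n<2^n e) (m≤n*m (2 ^ e) (2 * N) {{m*n≢0 2 N}}))
  search (suc f) e e+f≡K low with 2 * N * 2 ^ e ≤? K
  ... | yes doubled≤K = search f (suc e) (trans (sym (+-suc e f)) e+f≡K) (inj₂ (subst (_≤ K) (double N (2 ^ e)) doubled≤K))
    where
    double : ∀ N x → 2 * N * x ≡ N * (2 * x)
    double = solve-∀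
  ... | no doubled≰K = e , low , ≰⇒> doubled≰K

-- Rounding K up to M = m * 2 ^ e with a mantissa m ≤ 2N loses at most a
-- factor 1 + 1/N, and e ≤ ⌈log₂ K⌉, so M has a description of
-- O(log log K + N) bits.
record Rounding (N K : ℕ) : Set where
  field
    e m : ℕ
    K≤M : K ≤ m * 2 ^ e
    accurate : m * 2 ^ e * N ≤ suc N * K
    m≤2N : m ≤ 2 * N
    e≤log : e ≤ ⌈log₂ K ⌉

rounding : ∀ N K .{{_ : NonZero N}} → Rounding N K
rounding N K with exponent N K
... | (e , low , high) with round-up (2 ^ e) K {{m^n≢0 2 e}}
...   | (m , K≤M , M<K+2^e) = record { e = e ; m = m ; K≤M = K≤M ; accurate = accurate low ; m≤2N = m≤2N ; e≤log = e≤log low }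
  where
  accurate : (e ≡ 0 ⊎ N * 2 ^ e ≤ K) → m * 2 ^ e * N ≤ suc N * K
  accurate (inj₁ refl) = begin
    m * 1 * N     ≤⟨ *-monoˡ-≤ N (≤-pred (subst (m * 1 <_) (+-comm K 1) M<K+2^e)) ⟩
    K * N         ≤⟨ m≤n+m (K * N) K ⟩
    K + K * N     ≡⟨ cong (K +_) (*-comm K N) ⟩
    suc N * K     ∎
    where open ≤-Reasoning
  accurate (inj₂ N2^e≤K) = begin
    m * 2 ^ e * N        ≤⟨ *-monoˡ-≤ N (<⇒≤ M<K+2^e) ⟩
    (K + 2 ^ e) * N      ≡⟨ rearrange K (2 ^ e) N ⟩
    K * N + N * 2 ^ e    ≤⟨ +-monoʳ-≤ (K * N) N2^e≤K ⟩
    K * N + K            ≡⟨ rearrange′ K N ⟩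
    suc N * K            ∎
    where
    open ≤-Reasoning
    rearrange : ∀ K g N → (K + g) * N ≡ K * N + N * g
    rearrange = solve-∀
    rearrange′ : ∀ K N → K * N + K ≡ suc N * K
    rearrange′ = solve-∀
  m≤2N : m ≤ 2 * N
  m≤2N = ≤-pred (*-cancelʳ-< (2 ^ e) m (suc (2 * N)) (begin-strict
    m * 2 ^ e              <⟨ M<K+2^e ⟩
    K + 2 ^ e              <⟨ +-monoˡ-< (2 ^ e) high ⟩
    2 * N * 2 ^ e + 2 ^ e  ≡⟨ +-comm (2 * N * 2 ^ e) (2 ^ e) ⟩
    suc (2 * N) * 2 ^ e    ∎))
    where open ≤-Reasoning
  e≤log : (e ≡ 0 ⊎ N * 2 ^ e ≤ K) → e ≤ ⌈log₂ K ⌉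
  e≤log (inj₁ refl) = z≤n
  e≤log (inj₂ N2^e≤K) = ≤-⌈log₂⌉ (≤-trans (m≤n*m (2 ^ e) N) N2^e≤K)

-- A codeword of length at most
-- 2 ⌈log₂ ⌈log₂ K⌉⌉ + C exceeds it only when K is so large that the fresh
-- colours used while the codeword is read are negligible: (ℓ ∸ H) * N ≤ K.
module InitialBudget (N C : ℕ) where

  threshold : ℕ
  threshold = proj₁ (linear≤exponential (N * (C + 2)) (2 * N))

  H : ℕ
  H = C + 2 * threshold

  fresh-bound : ∀ K ℓ → ℓ ≤ 2 * ⌈log₂ ⌈log₂ K ⌉ ⌉ + C → (ℓ ∸ H) * N ≤ K
  fresh-bound K ℓ ℓ≤ with ℓ ≤? H
  ... | yes ℓ≤H rewrite m≤n⇒m∸n≡0 ℓ≤H = z≤n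
  ... | no ℓ≰H with m≤n⇒∃[o]m+o≡n threshold<d
    where
    d c : ℕ
    d = ⌈log₂ K ⌉
    c = ⌈log₂ d ⌉
    threshold<c : threshold < c
    threshold<c = *-cancelˡ-< 2 threshold c (+-cancelʳ-< C (2 * threshold) (2 * c)
      (subst (_< 2 * c + C) (+-comm C (2 * threshold)) (<-≤-trans (≰⇒> ℓ≰H) ℓ≤)))
    threshold<d : threshold < d
    threshold<d = <-≤-trans threshold<c (⌈log₂n⌉≤n d)
  ... | (o , 1+t+o≡d) = ≤-trans (*-monoˡ-≤ N (m∸n≤m ℓ H)) (<⇒≤ (begin-strict
    ℓ * N                         ≤⟨ *-monoˡ-≤ N (≤-trans ℓ≤ (+-monoˡ-≤ C (*-monoʳ-≤ 2 (⌈log₂n⌉≤n ⌈log₂ K ⌉)))) ⟩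
    (2 * ⌈log₂ K ⌉ + C) * N       ≡⟨ cong (λ d → (2 * d + C) * N) (sym 1+t+o≡d) ⟩
    (2 * suc D + C) * N           ≡⟨ rearrange D N C ⟩
    N * (C + 2) + 2 * N * D       ≤⟨ proj₂ (linear≤exponential (N * (C + 2)) (2 * N)) D (m≤m+n threshold o) ⟩
    2 ^ D                         <⟨ 2^D<K ⟩
    K                             ∎))
    where
    open ≤-Reasoning
    D : ℕ
    D = threshold + o
    rearrange : ∀ D N C → (2 * suc D + C) * N ≡ N * (C + 2) + 2 * N * D
    rearrange = solve-∀
    -- ⌈log₂ K⌉ = D + 1 means K > 2 ^ D
    2^D<K : 2 ^ D < K
    2^D<K = ≰⇒> (λ K≤2^D → 1+n≰n (subst (_≤ D) (sym 1+t+o≡d) (⌈log₂⌉-≤ K≤2^D)))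

ℕtoℚ-normal : ∀ x → ℕtoℚ x ≡ mkℚ (ℤ.+ x) 0 (Coprimality.sym (Coprimality.1-coprimeTo x))
ℕtoℚ-normal x = ℚ.normalize-coprime (Coprimality.sym (Coprimality.1-coprimeTo x))

ratio-bound : ∀ p q .(c : Coprime (suc p) (suc q)) X k → X * suc q ≤ (suc q + 1) * k →
              ℕtoℚ X ℚ.≤ (1ℚ ℚ.+ mkℚ +[1+ p ] q c) ℚ.* ℕtoℚ k
ratio-bound p q c X k X≤ = ℚ.toℚᵘ-cancel-≤ (ℚᵘ.≤-respʳ-≃ (ℚᵘ.≃-sym rhs≃) unnormalised)
  where
  ε : ℚ
  ε = mkℚ +[1+ p ] q c
  rhs≃ : ℚ.toℚᵘ ((1ℚ ℚ.+ ε) ℚ.* ℕtoℚ k) ℚᵘ.≃ (ℚᵘ.mkℚᵘ (ℤ.+ 1) 0 ℚᵘ.+ ℚᵘ.mkℚᵘ +[1+ p ] q) ℚᵘ.* ℚᵘ.mkℚᵘ (ℤ.+ k) 0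
  rhs≃ = ℚᵘ.≃-trans (ℚ.toℚᵘ-homo-* (1ℚ ℚ.+ ε) (ℕtoℚ k))
           (ℚᵘ.*-cong (ℚ.toℚᵘ-homo-+ 1ℚ ε) (subst (λ z → ℚ.toℚᵘ z ℚᵘ.≃ ℚᵘ.mkℚᵘ (ℤ.+ k) 0) (sym (ℕtoℚ-normal k)) ℚᵘ.≃-refl))
  -- cross-multiplied, the inequality is the hypothesis weakened by ε ≥ 1/(q+1)
  unnormalised : ℚ.toℚᵘ (ℕtoℚ X) ℚᵘ.≤ (ℚᵘ.mkℚᵘ (ℤ.+ 1) 0 ℚᵘ.+ ℚᵘ.mkℚᵘ +[1+ p ] q) ℚᵘ.* ℚᵘ.mkℚᵘ (ℤ.+ k) 0
  unnormalised rewrite ℕtoℚ-normal X = ℚᵘ.*≤* (subst₂ ℤ._≤_ (ℤ.pos-* X (suc ((q + 0) * 1)))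
      (trans (sym (ℤ.+◃n≡+n _)) (sym (ℤ.*-identityʳ _))) (ℤ.+≤+ cross))
    where
    cross : X * suc ((q + 0) * 1) ≤ k + (q + 0 + suc (p * 1)) * k
    cross rewrite *-identityʳ (q + 0) | +-identityʳ q =
      ≤-trans X≤ (+-monoʳ-≤ k (*-monoˡ-≤ k (+-monoʳ-≤ q (s≤s z≤n))))

module Advice (N : ℕ) .{{_ : NonZero N}} (K : ℕ) where
  open Rounding (rounding N K) public

  c L : ℕ
  c = ⌈log₂ ⌈log₂ K ⌉ ⌉
  L = suc c

  M : ℕ
  M = m * 2 ^ e

  cd : List Bool
  cd = codeword L e m

  e<2^L : e < 2 ^ L
  e<2^L = begin-strict
    e            ≤⟨ e≤log ⟩
    ⌈log₂ K ⌉    ≤⟨ n≤2^⌈log₂n⌉ ⌈log₂ K ⌉ ⟩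
    2 ^ c        <⟨ m<m+n (2 ^ c) (+-monoˡ-≤ 0 (m^n>0 2 c)) ⟩
    2 ^ c + (2 ^ c + 0) ∎
    where open ≤-Reasoning

  exact : Exact codeD cd M
  exact = exact-codeword L e m e<2^L

  length-cd : length cd ≤ 2 * c + (2 * N + 4)
  length-cd = begin
    length cd               ≡⟨ length-codeword L e m ⟩
    2 * suc c + m + 2       ≤⟨ +-monoˡ-≤ 2 (+-monoʳ-≤ (2 * suc c) m≤2N) ⟩
    2 * suc c + 2 * N + 2   ≡⟨ rearrange c N ⟩
    2 * c + (2 * N + 4)     ∎
    where
    open ≤-Reasoning
    rearrange : ∀ c N → 2 * suc c + 2 * N + 2 ≡ 2 * c + (2 * N + 4)
    rearrange = solve-∀

colours-arith : ∀ q {X R M K k} → X ≤ R + M → R * (2 * suc q) ≤ K → M * (2 * suc q) ≤ suc (2 * suc q) * K → K ≤ k →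
                X * suc q ≤ (suc q + 1) * k
colours-arith q {X} {R} {M} {K} {k} X≤R+M RN≤K MN≤ K≤k = *-cancelˡ-≤ 2 (begin
  2 * (X * suc q)               ≡⟨ double X (suc q) ⟩
  X * N                         ≤⟨ *-monoˡ-≤ N X≤R+M ⟩
  (R + M) * N                   ≡⟨ *-distribʳ-+ N R M ⟩
  R * N + M * N                 ≤⟨ +-mono-≤ RN≤K MN≤ ⟩
  K + suc N * K                 ≡⟨ regroup K (suc q) ⟩
  2 * ((suc q + 1) * K)         ≤⟨ *-monoʳ-≤ 2 (*-monoʳ-≤ (suc q + 1) K≤k) ⟩
  2 * ((suc q + 1) * k)         ∎)
  where
  open ≤-Reasoning
  N : ℕ
  N = 2 * suc q
  double : ∀ X q → 2 * (X * q) ≡ X * (2 * q)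
  double = solve-∀
  regroup : ∀ K q → K + suc (2 * q) * K ≡ 2 * ((q + 1) * K)
  regroup = solve-∀

advice-arith : ∀ {ℓ c c′} C → 2 ≤ C → ℓ ≤ 2 * c + C → c ≤ c′ → ℓ ≤ C * c′ + C
advice-arith C 2≤C ℓ≤ c≤c′ = ≤-trans ℓ≤ (+-monoˡ-≤ C (*-mono-≤ 2≤C c≤c′))

module Guarantee (q : ℕ) where

  N C : ℕ
  N = 2 * suc q
  C = 2 * N + 4

  open InitialBudget N C public using (H; fresh-bound)

  guarantee : (n : ℕ) (E : Adj n) → SimpleGraph n E → Bipartite n E → (I : List (Fin n)) →
    Σ (ℕ → Bool) λ t →
      Valid E (output (run (algorithm H) n E t I))
      × ((k : ℕ) → IsOpt E I k →
          (numColors (map proj₂ (output (run (algorithm H) n E t I))) * suc q ≤ (suc q + 1) * k)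
          × (adviceUsed {n} (run (algorithm H) n E t I) ≤ C * ⌈log₂ ⌈log₂ k ⌉ ⌉ + C))
  guarantee n E simple bipartite I = tapeOf cd , valid , λ k opt → competitive k opt , advice k opt
    where
    open MaxLoad E I using (maxLoad; count≤maxLoad; edge-count≤maxLoad; maxLoad≤Opt)
    open Advice N maxLoad using (cd; M; exact; length-cd; K≤M; accurate)
    open Run H cd M exact using (run-algorithm)
    open Schedule (findSides n E) H (length cd) M using (schedule)
    open Schedule.Correctness (findSides n E) H (length cd) M E I (findSides-proper n E bipartite)
      (λ v → ≤-trans (count≤maxLoad v) K≤M)
      (λ u v uv → ≤-trans (edge-count≤maxLoad simple u v uv) K≤M)
      using (schedule-correct)

    result : List (Fin n × ℕ) × ℕ
    result = run (algorithm H) n E (tapeOf cd) I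

    produces-schedule : output result ≡ schedule I []
    produces-schedule = proj₁ (run-algorithm E I)

    valid : Valid E (output result)
    valid = subst (Valid E) (sym produces-schedule) (proj₁ schedule-correct)

    competitive : ∀ k → IsOpt E I k → numColors (map proj₂ (output result)) * suc q ≤ (suc q + 1) * k
    competitive k opt = subst (λ h → numColors (map proj₂ h) * suc q ≤ (suc q + 1) * k) (sym produces-schedule)
      (colours-arith q {R = length cd ∸ H} {M = M} (proj₂ schedule-correct) (fresh-bound maxLoad (length cd) length-cd) accurate (maxLoad≤Opt simple k opt))

    advice : ∀ k → IsOpt E I k → adviceUsed {n} result ≤ C * ⌈log₂ ⌈log₂ k ⌉ ⌉ + C
    advice k opt = ≤-trans (proj₂ (run-algorithm E I))
      (advice-arith C (≤-trans (s≤s (s≤s z≤n)) (m≤n+m 4 (2 * N))) length-cd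
        (⌈log₂⌉-mono-≤ (⌈log₂⌉-mono-≤ (maxLoad≤Opt simple k opt))))

corollary1 : (ε : ℚ) → ε ℚ.> 0ℚ →
    Σ OnlineAlg λ A → Σ ℕ λ C →
      (n : ℕ) (E : Adj n) → SimpleGraph n E → Bipartite n E →
      (I : List (Fin n)) → Σ (ℕ → Bool) λ t →
        Valid E (output (run A n E t I))
        × ((k : ℕ) → IsOpt E I k →
            (ℕtoℚ (numColors (map proj₂ (output (run A n E t I))))
               ℚ.≤ (1ℚ ℚ.+ ε) ℚ.* ℕtoℚ k)
            × (adviceUsed (run A n E t I) ≤ C * ⌈log₂ ⌈log₂ k ⌉ ⌉ + C))
corollary1 (mkℚ (ℤ.+ 0) _ _) (*<* (+<+ ()))
corollary1 (mkℚ -[1+ _ ] _ _) (*<* ())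
corollary1 (mkℚ +[1+ p ] q coprime) _ = algorithm H , C , λ n E simple bipartite I →
  let (t , valid , bounds) = guarantee n E simple bipartite I in
  t , valid , λ k opt →
    ratio-bound p q coprime (numColors (map proj₂ (output (run (algorithm H) n E t I)))) k (proj₁ (bounds k opt))
    , proj₂ (bounds k opt)
  where open Guarantee q
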